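{- Let $p$ be a prime, $k\ge 2$ an integer and $c$ an integer. Let $a,b\in\mathbb{Z}_p$ with $a\neq b$ and let $f(x)=(x-a)(x-b)$. Then $$\mathcal{M}_{k,f,c}(p)=p^{k-1}-\frac{(-1)^k}{p}\Big(p\sum_{\substack{j=0\\ (a-b)j\equiv c-bk\pmod p}}^{k}\binom{k}{j}+(2-p)^k-2^k\Big).$$
   Context: $\mathbb{Z}_p=\{0,1,\dots,p-1\}$ is the ring of residue classes modulo $p$. For $f(x)\in\mathbb{Z}[x]$, $$\mathcal{M}_{k,f,c}(p)=\#\Big\{(x_1,\dots,x_{k-1})\in\mathbb{Z}_p^{k-1}: f(x_1)\cdots f(x_{k-1})\,f\Big(c-\sum_{i=1}^{k-1}x_i\Big)\equiv 0\pmod p\Big\}.$$ -}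

module Defs where

open import Data.Nat as ℕ using (ℕ; zero; suc; _∸_)
open import Data.Nat.Combinatorics using (_C_)
open import Data.Integer as ℤ using (ℤ; +_; _-_; _*_; _+_)
open import Data.Integer.Divisibility.Signed using (_∣_; _∣?_)
open import Data.List using (List; []; _∷_; [_]; map; concatMap; upTo; length; filter; foldr)
open import Relation.Nullary.Decidable using (¬?)

tuples : ℕ → ℕ → List (List ℕ)
tuples zero    p = [ [] ]
tuples (suc n) p = concatMap (λ x → map (x ∷_) (tuples n p)) (upTo p)

sumℤ : List ℤ → ℤ
sumℤ = foldr _+_ (+ 0)

prodℤ : List ℤ → ℤ
prodℤ = foldr _*_ (+ 1)

fab : ℤ → ℤ → ℤ → ℤ
fab a b x = (x - a) * (x - b)

prodTerm : (ℤ → ℤ) → ℤ → List ℕ → ℤ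
prodTerm f c xs =
  prodℤ (map (λ x → f (+ x)) xs) * f (c - sumℤ (map +_ xs))

M : ℕ → (ℤ → ℤ) → ℤ → ℕ → ℕ
M k f c p = length (filter (λ xs → (+ p) ∣? prodTerm f c xs) (tuples (k ∸ 1) p))

binomSum : ℕ → ℤ → ℤ → ℤ → ℕ → ℤ
binomSum k a b c p =
  sumℤ (map (λ j → + (k C j))
            (filter (λ j → (+ p) ∣? (((a - b) * (+ j)) - (c - b * (+ k)))) (upTo (suc k))))

{-# OPTIONS --safe #-}
module Submission where

-- Count the complement instead: Mᶜ m c, the number of x ∈ ℤ_p^m with
-- f(x₁)⋯f(xₘ) f(c − Σ xᵢ) ≢ 0 (mod p), satisfies the convolution recursion
-- Mᶜ (m+1) c = Σ_{x ∉ {a,b}} Mᶜ m (c − x).  The binomial sum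
-- B k c = Σ_{(a−b)j ≡ c−bk} C(k,j) obeys the Pascal-type recursion
-- B (k+1) c = B k (c − b) + B k (c − a), and summing B k over all shifts of c
-- gives 2^k, since every j lies in exactly one residue class.  Together these
-- make p·Mᶜ (k−1) c = (−1)^k (p·B k c + (2−p)^k − 2^k) an induction on k,
-- and M = p^(k−1) − Mᶜ.

open import Defs
open import Data.Nat as ℕ using (ℕ; _≤_; _<_; _∸_)
open import Data.Nat.Primality using (Prime; euclidsLemma; prime⇒nonZero)
open import Data.Integer as ℤ using (ℤ; +_; -_; _-_; _*_; _+_; _^_)
open import Relation.Binary.PropositionalEquality using (_≡_; _≢_)

open import Data.Nat using (zero; suc; s≤s)
import Data.Nat.Properties as NP
import Data.Nat.Divisibility as ND
open import Data.Nat.Combinatorics using (_C_; nCk+nC[k+1]≡[n+1]C[k+1]; k>n⇒nCk≡0)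
import Data.Integer.Properties as IP
open import Data.Integer.DivMod using (_%ℕ_; _/ℕ_; n%ℕd<d; a≡a%ℕn+[a/ℕn]*n)
open import Data.Integer.Divisibility.Signed
  using (_∣_; _∣?_; ∣⇒∣ᵤ; ∣ᵤ⇒∣; ∣-refl; ∣m⇒∣-m; ∣m⇒∣m*n; ∣n⇒∣m*n
        ; ∣m∣n⇒∣m-n; ∣m+n∣n⇒∣m; ∣m∣n⇒∣m+n)
open import Data.Integer.Tactic.RingSolver using (solve-∀)
open import Data.List using (List; []; _∷_; map; concatMap; upTo; applyUpTo; length; filter; _++_)
import Data.List.Properties as LP
open import Data.Sum using (_⊎_; inj₁; inj₂; [_,_]′)
open import Function using (_∘_; id)
open import Relation.Nullary using (yes; no; ¬_; contradiction)
open import Relation.Binary.PropositionalEquality using (refl; sym; trans; cong; cong₂; subst; module ≡-Reasoning)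

open ≡-Reasoning

∑ : ℕ → (ℕ → ℤ) → ℤ
∑ zero    g = + 0
∑ (suc n) g = g 0 + ∑ n (g ∘ suc)

∑-cong : ∀ n {g h : ℕ → ℤ} → (∀ i → i < n → g i ≡ h i) → ∑ n g ≡ ∑ n h
∑-cong zero    eq = refl
∑-cong (suc n) eq = cong₂ _+_ (eq 0 (s≤s ℕ.z≤n)) (∑-cong n (λ i i<n → eq (suc i) (s≤s i<n)))

∑-distrib-+ : ∀ n g h → ∑ n (λ i → g i + h i) ≡ ∑ n g + ∑ n h
∑-distrib-+ zero    g h = refl
∑-distrib-+ (suc n) g h = trans (cong (_+_ (g 0 + h 0)) (∑-distrib-+ n _ _)) (interchange (g 0) (h 0) _ _)
  where
  interchange : ∀ x y u v → x + y + (u + v) ≡ x + u + (y + v)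
  interchange = solve-∀

∑-distrib-- : ∀ n g h → ∑ n (λ i → g i - h i) ≡ ∑ n g - ∑ n h
∑-distrib-- zero    g h = refl
∑-distrib-- (suc n) g h = trans (cong (_+_ (g 0 - h 0)) (∑-distrib-- n _ _)) (interchange (g 0) (h 0) _ _)
  where
  interchange : ∀ x y u v → x - y + (u - v) ≡ x + u - (y + v)
  interchange = solve-∀

∑-*ˡ : ∀ n c g → ∑ n (λ i → c * g i) ≡ c * ∑ n g
∑-*ˡ zero    c g = sym (IP.*-zeroʳ c)
∑-*ˡ (suc n) c g = trans (cong (_+_ (c * g 0)) (∑-*ˡ n c _)) (sym (IP.*-distribˡ-+ c (g 0) _))

∑-const : ∀ n c → ∑ n (λ _ → c) ≡ + n * c
∑-const zero    c = refl
∑-const (suc n) c = trans (cong (_+_ c) (∑-const n c)) (sym (IP.suc-* (+ n) c))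

∑-snoc : ∀ n g → ∑ (suc n) g ≡ ∑ n g + g n
∑-snoc zero    g = IP.+-comm (g 0) (+ 0)
∑-snoc (suc n) g = trans (cong (_+_ (g 0)) (∑-snoc n (g ∘ suc))) (sym (IP.+-assoc (g 0) _ _))

∑-comm : ∀ n m (h : ℕ → ℕ → ℤ) → ∑ n (λ i → ∑ m (h i)) ≡ ∑ m (λ j → ∑ n (λ i → h i j))
∑-comm zero    m h = sym (trans (∑-const m (+ 0)) (IP.*-zeroʳ (+ m)))
∑-comm (suc n) m h = trans (cong (_+_ (∑ m (h 0))) (∑-comm n m (h ∘ suc)))
                           (sym (∑-distrib-+ m (h 0) (λ j → ∑ n (λ i → h (suc i) j))))

δ : ℕ → ℕ → ℤ
δ zero    zero    = + 1
δ zero    (suc _) = + 0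
δ (suc _) zero    = + 0
δ (suc m) (suc n) = δ m n

δ-refl : ∀ n → δ n n ≡ + 1
δ-refl zero    = refl
δ-refl (suc n) = δ-refl n

δ-≢ : ∀ {m n} → m ≢ n → δ m n ≡ + 0
δ-≢ {zero}  {zero}  m≢n = contradiction refl m≢n
δ-≢ {zero}  {suc n} m≢n = refl
δ-≢ {suc m} {zero}  m≢n = refl
δ-≢ {suc m} {suc n} m≢n = δ-≢ (m≢n ∘ cong suc)

∑-δ : ∀ n {a} (h : ℕ → ℤ) → a < n → ∑ n (λ x → δ a x * h x) ≡ h a
∑-δ (suc n) {zero}  h _         = trans (cong₂ _+_ (IP.*-identityˡ (h 0)) ∑-zero) (IP.+-identityʳ (h 0))
  where
  ∑-zero : ∑ n (λ _ → + 0) ≡ + 0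
  ∑-zero = trans (∑-const n (+ 0)) (IP.*-zeroʳ (+ n))
∑-δ (suc n) {suc a} h (s≤s a<n) = trans (IP.+-identityˡ _) (∑-δ n (h ∘ suc) a<n)

∑-pascal : ∀ k (h : ℕ → ℤ) →
  ∑ (suc (suc k)) (λ j → + (suc k C j) * h j) ≡
  ∑ (suc k) (λ j → + (k C j) * h j) + ∑ (suc k) (λ j → + (k C j) * h (suc j))
∑-pascal k h = begin
  h₀ + ∑ (suc k) (λ j → + (suc k C suc j) * h (suc j))   ≡⟨ cong (_+_ h₀) (∑-cong (suc k) (λ j _ → split j)) ⟩
  h₀ + ∑ (suc k) (λ j → X j + Y j)                        ≡⟨ cong (_+_ h₀) (∑-distrib-+ (suc k) X Y) ⟩
  h₀ + (∑ (suc k) X + ∑ (suc k) Y)                        ≡⟨ regroup h₀ (∑ (suc k) X) (∑ (suc k) Y) ⟩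
  (h₀ + ∑ (suc k) Y) + ∑ (suc k) X                        ≡⟨ cong (_+ ∑ (suc k) X) shifted ⟩
  ∑ (suc k) (λ j → + (k C j) * h j) + ∑ (suc k) X         ∎
  where
  h₀ : ℤ
  h₀ = + 1 * h 0
  X Y : ℕ → ℤ
  X j = + (k C j) * h (suc j)
  Y j = + (k C suc j) * h (suc j)
  split : ∀ j → + (suc k C suc j) * h (suc j) ≡ X j + Y j
  split j = trans (cong (λ n → + n * h (suc j)) (sym (nCk+nC[k+1]≡[n+1]C[k+1] k j)))
                  (IP.*-distribʳ-+ (h (suc j)) (+ (k C j)) (+ (k C suc j)))
  regroup : ∀ x u v → x + (u + v) ≡ (x + v) + u
  regroup = solve-∀
  shifted : h₀ + ∑ (suc k) Y ≡ ∑ (suc k) (λ j → + (k C j) * h j)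
  shifted = trans (∑-snoc (suc k) (λ j → + (k C j) * h j))
                  (trans (cong (λ n → ∑ (suc k) (λ j → + (k C j) * h j) + + n * h (suc k))
                               (k>n⇒nCk≡0 (NP.n<1+n k)))
                         (IP.+-identityʳ _))

∑-binomial : ∀ k → ∑ (suc k) (λ j → + (k C j)) ≡ (+ 2) ^ k
∑-binomial zero    = refl
∑-binomial (suc k) = begin
  ∑ (suc (suc k)) (λ j → + (suc k C j))
    ≡⟨ ∑-cong (suc (suc k)) (λ j _ → sym (IP.*-identityʳ (+ (suc k C j)))) ⟩
  ∑ (suc (suc k)) (λ j → + (suc k C j) * + 1)                           ≡⟨ ∑-pascal k (λ _ → + 1) ⟩
  ∑ (suc k) (λ j → + (k C j) * + 1) + ∑ (suc k) (λ j → + (k C j) * + 1) ≡⟨ cong (λ s → s + s) previous ⟩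
  (+ 2) ^ k + (+ 2) ^ k                                                 ≡⟨ double ((+ 2) ^ k) ⟩
  (+ 2) ^ suc k                                                         ∎
  where
  previous : ∑ (suc k) (λ j → + (k C j) * + 1) ≡ (+ 2) ^ k
  previous = trans (∑-cong (suc k) (λ j _ → IP.*-identityʳ (+ (k C j)))) (∑-binomial k)
  double : ∀ t → t + t ≡ + 2 * t
  double = solve-∀

module _ {A : Set} where

  sumℤ-++ : (xs ys : List ℤ) → sumℤ (xs ++ ys) ≡ sumℤ xs + sumℤ ys
  sumℤ-++ []       ys = sym (IP.+-identityˡ _)
  sumℤ-++ (x ∷ xs) ys = trans (cong (_+_ x) (sumℤ-++ xs ys)) (sym (IP.+-assoc x _ _))

  sumℤ-cong : ∀ {g h : A → ℤ} L → (∀ x → g x ≡ h x) → sumℤ (map g L) ≡ sumℤ (map h L)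
  sumℤ-cong L eq = cong sumℤ (LP.map-cong eq L)

  sumℤ-map-+ : ∀ (g h : A → ℤ) L → sumℤ (map (λ x → g x + h x) L) ≡ sumℤ (map g L) + sumℤ (map h L)
  sumℤ-map-+ g h []      = refl
  sumℤ-map-+ g h (x ∷ L) = trans (cong (_+_ (g x + h x)) (sumℤ-map-+ g h L)) (interchange (g x) (h x) _ _)
    where
    interchange : ∀ x y u v → x + y + (u + v) ≡ x + u + (y + v)
    interchange = solve-∀

  sumℤ-map-*ˡ : ∀ c (g : A → ℤ) L → sumℤ (map (λ x → c * g x) L) ≡ c * sumℤ (map g L)
  sumℤ-map-*ˡ c g []      = sym (IP.*-zeroʳ c)
  sumℤ-map-*ˡ c g (x ∷ L) = trans (cong (_+_ (c * g x)) (sumℤ-map-*ˡ c g L)) (sym (IP.*-distribˡ-+ c (g x) _))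

  sumℤ-map-1 : (L : List A) → sumℤ (map (λ _ → + 1) L) ≡ + length L
  sumℤ-map-1 []      = refl
  sumℤ-map-1 (x ∷ L) = cong (_+_ (+ 1)) (sumℤ-map-1 L)

  sumℤ-map-concatMap : ∀ {B : Set} (g : B → ℤ) (h : A → List B) L →
    sumℤ (map g (concatMap h L)) ≡ sumℤ (map (λ x → sumℤ (map g (h x))) L)
  sumℤ-map-concatMap g h []      = refl
  sumℤ-map-concatMap g h (x ∷ L) = begin
    sumℤ (map g (h x ++ concatMap h L))              ≡⟨ cong sumℤ (LP.map-++ g (h x) (concatMap h L)) ⟩
    sumℤ (map g (h x) ++ map g (concatMap h L))      ≡⟨ sumℤ-++ (map g (h x)) _ ⟩
    sumℤ (map g (h x)) + sumℤ (map g (concatMap h L)) ≡⟨ cong (_+_ (sumℤ (map g (h x)))) (sumℤ-map-concatMap g h L) ⟩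
    sumℤ (map (λ y → sumℤ (map g (h y))) (x ∷ L))    ∎

sumℤ-applyUpTo : ∀ n g → sumℤ (applyUpTo g n) ≡ ∑ n g
sumℤ-applyUpTo zero    g = refl
sumℤ-applyUpTo (suc n) g = cong (_+_ (g 0)) (sumℤ-applyUpTo n (g ∘ suc))

sumℤ-map-upTo : ∀ n g → sumℤ (map g (upTo n)) ≡ ∑ n g
sumℤ-map-upTo n g = trans (cong sumℤ (LP.map-applyUpTo id g n)) (sumℤ-applyUpTo n g)

sumℤ-tuples-suc : ∀ m p (g : List ℕ → ℤ) →
  sumℤ (map g (tuples (suc m) p)) ≡ ∑ p (λ x → sumℤ (map (g ∘ (x ∷_)) (tuples m p)))
sumℤ-tuples-suc m p g = begin
  sumℤ (map g (concatMap (λ x → map (x ∷_) (tuples m p)) (upTo p)))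
    ≡⟨ sumℤ-map-concatMap g (λ x → map (x ∷_) (tuples m p)) (upTo p) ⟩
  sumℤ (map (λ x → sumℤ (map g (map (x ∷_) (tuples m p)))) (upTo p))
    ≡⟨ sumℤ-cong (upTo p) (λ x → cong sumℤ (sym (LP.map-∘ (tuples m p)))) ⟩
  sumℤ (map (λ x → sumℤ (map (g ∘ (x ∷_)) (tuples m p))) (upTo p))
    ≡⟨ sumℤ-map-upTo p _ ⟩
  ∑ p (λ x → sumℤ (map (g ∘ (x ∷_)) (tuples m p)))
    ∎

length-tuples : ∀ m p → + length (tuples m p) ≡ (+ p) ^ m
length-tuples zero    p = refl
length-tuples (suc m) p = begin
  + length (tuples (suc m) p)                               ≡⟨ sym (sumℤ-map-1 (tuples (suc m) p)) ⟩
  sumℤ (map (λ _ → + 1) (tuples (suc m) p))                 ≡⟨ sumℤ-tuples-suc m p (λ _ → + 1) ⟩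
  ∑ p (λ _ → sumℤ (map (λ _ → + 1) (tuples m p)))           ≡⟨ ∑-const p _ ⟩
  + p * sumℤ (map (λ _ → + 1) (tuples m p))
    ≡⟨ cong (+ p *_) (trans (sumℤ-map-1 (tuples m p)) (length-tuples m p)) ⟩
  (+ p) ^ suc m                                               ∎

prodTerm-∷ : ∀ f c x xs → prodTerm f c (x ∷ xs) ≡ f (+ x) * prodTerm f (c - + x) xs
prodTerm-∷ f c x xs = trans (IP.*-assoc (f (+ x)) _ _)
  (cong (λ s → f (+ x) * (prodℤ (map (f ∘ +_) xs) * f s)) (shift c (+ x) (sumℤ (map +_ xs))))
  where
  shift : ∀ c x s → c - (x + s) ≡ (c - x) - s
  shift = solve-∀

∣∧<⇒≡0 : ∀ {p n} → p ND.∣ n → n < p → n ≡ 0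
∣∧<⇒≡0 {n = zero}  _   _   = refl
∣∧<⇒≡0 {n = suc _} p∣n n<p = contradiction p∣n (ND.>⇒∤ n<p)

∣m-n∣≡n∸m : ∀ {m n} → m ≤ n → ℤ.∣ + m - + n ∣ ≡ n ∸ m
∣m-n∣≡n∸m {m} {n} m≤n = trans (cong ℤ.∣_∣ (IP.m-n≡m⊖n m n)) (IP.∣⊖∣-≤ m≤n)

∣m-n∣<p : ∀ {p m n} → m < p → n < p → ℤ.∣ + m - + n ∣ < p
∣m-n∣<p {p} {m} {n} m<p n<p with NP.≤-total m n
... | inj₁ m≤n = subst (_< p) (sym (∣m-n∣≡n∸m m≤n)) (NP.≤-<-trans (NP.m∸n≤m n m) n<p)
... | inj₂ n≤m = subst (_< p) (sym (trans (IP.∣i-j∣≡∣j-i∣ (+ m) (+ n)) (∣m-n∣≡n∸m n≤m)))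
                       (NP.≤-<-trans (NP.m∸n≤m m n) m<p)

∣m-n⇒m≡n : ∀ {p m n} → m < p → n < p → + p ∣ + m - + n → m ≡ n
∣m-n⇒m≡n {m = m} {n} m<p n<p p∣m-n =
  IP.+-injective (IP.i-j≡0⇒i≡j (+ m) (+ n) (IP.∣i∣≡0⇒i≡0 (∣∧<⇒≡0 (∣⇒∣ᵤ p∣m-n) (∣m-n∣<p m<p n<p))))

∣*⇒∣⊎∣ : ∀ {p} → Prime p → ∀ u v → + p ∣ u * v → + p ∣ u ⊎ + p ∣ v
∣*⇒∣⊎∣ {p} p-prime u v p∣uv
  with euclidsLemma ℤ.∣ u ∣ ℤ.∣ v ∣ p-prime (subst (p ND.∣_) (IP.abs-* u v) (∣⇒∣ᵤ p∣uv))
... | inj₁ p∣u = inj₁ (∣ᵤ⇒∣ p∣u)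
... | inj₂ p∣v = inj₂ (∣ᵤ⇒∣ p∣v)

⟦_∣_⟧ : ℕ → ℤ → ℤ
⟦ p ∣ z ⟧ with + p ∣? z
... | yes _ = + 1
... | no  _ = + 0

⟦_∤_⟧ : ℕ → ℤ → ℤ
⟦ p ∤ z ⟧ = + 1 - ⟦ p ∣ z ⟧

module _ {p : ℕ} where

  ∣⇒⟦∣⟧≡1 : ∀ {z} → + p ∣ z → ⟦ p ∣ z ⟧ ≡ + 1
  ∣⇒⟦∣⟧≡1 {z} p∣z with + p ∣? z
  ... | yes _   = refl
  ... | no  p∤z = contradiction p∣z p∤z

  ∤⇒⟦∣⟧≡0 : ∀ {z} → ¬ + p ∣ z → ⟦ p ∣ z ⟧ ≡ + 0
  ∤⇒⟦∣⟧≡0 {z} p∤z with + p ∣? z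
  ... | yes p∣z = contradiction p∣z p∤z
  ... | no  _   = refl

  ∣⇒⟦∤⟧≡0 : ∀ {z} → + p ∣ z → ⟦ p ∤ z ⟧ ≡ + 0
  ∣⇒⟦∤⟧≡0 p∣z = cong (_-_ (+ 1)) (∣⇒⟦∣⟧≡1 p∣z)

  ∤⇒⟦∤⟧≡1 : ∀ {z} → ¬ + p ∣ z → ⟦ p ∤ z ⟧ ≡ + 1
  ∤⇒⟦∤⟧≡1 p∤z = cong (_-_ (+ 1)) (∤⇒⟦∣⟧≡0 p∤z)

  ⟦∣⟧+⟦∤⟧≡1 : ∀ z → ⟦ p ∣ z ⟧ + ⟦ p ∤ z ⟧ ≡ + 1
  ⟦∣⟧+⟦∤⟧≡1 z = cancel ⟦ p ∣ z ⟧
    where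
    cancel : ∀ d → d + (+ 1 - d) ≡ + 1
    cancel = solve-∀

  ⟦∣⟧-neg : ∀ z → ⟦ p ∣ - z ⟧ ≡ ⟦ p ∣ z ⟧
  ⟦∣⟧-neg z with + p ∣? z
  ... | yes p∣z = ∣⇒⟦∣⟧≡1 (∣m⇒∣-m p∣z)
  ... | no  p∤z = ∤⇒⟦∣⟧≡0 (p∤z ∘ subst (+ p ∣_) (IP.neg-involutive z) ∘ ∣m⇒∣-m)

  ⟦∣⟧-+∣ : ∀ {d} → + p ∣ d → ∀ z → ⟦ p ∣ z + d ⟧ ≡ ⟦ p ∣ z ⟧
  ⟦∣⟧-+∣ p∣d z with + p ∣? z
  ... | yes p∣z = ∣⇒⟦∣⟧≡1 (∣m∣n⇒∣m+n p∣z p∣d)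
  ... | no  p∤z = ∤⇒⟦∣⟧≡0 (λ p∣z+d → p∤z (∣m+n∣n⇒∣m p∣z+d p∣d))

  ⟦∣⟧-residue : ∀ {x y} → x < p → y < p → ⟦ p ∣ + x - + y ⟧ ≡ δ y x
  ⟦∣⟧-residue {x} {y} x<p y<p with x ℕ.≟ y
  ... | yes refl = trans (∣⇒⟦∣⟧≡1 (subst (+ p ∣_) (sym (IP.+-inverseʳ (+ x))) (∣ᵤ⇒∣ (p ND.∣0)))) (sym (δ-refl x))
  ... | no  x≢y  = trans (∤⇒⟦∣⟧≡0 (x≢y ∘ ∣m-n⇒m≡n x<p y<p)) (sym (δ-≢ (x≢y ∘ sym)))

  ⟦∤⟧-* : Prime p → ∀ u v → ⟦ p ∤ u * v ⟧ ≡ ⟦ p ∤ u ⟧ * ⟦ p ∤ v ⟧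
  ⟦∤⟧-* p-prime u v with + p ∣? u | + p ∣? v
  ... | yes p∣u | _       = ∣⇒⟦∤⟧≡0 (∣m⇒∣m*n v p∣u)
  ... | no  _   | yes p∣v = ∣⇒⟦∤⟧≡0 (∣n⇒∣m*n u p∣v)
  ... | no  p∤u | no  p∤v = ∤⇒⟦∤⟧≡1 ([ p∤u , p∤v ]′ ∘ ∣*⇒∣⊎∣ p-prime u v)

  -- For r = (−t) mod p, the term t + x is divisible by p exactly when x = r.
  ∑-⟦∣+⟧ : .{{_ : ℕ.NonZero p}} → ∀ t → ∑ p (λ x → ⟦ p ∣ t + + x ⟧) ≡ + 1
  ∑-⟦∣+⟧ t = begin
    ∑ p (λ x → ⟦ p ∣ t + + x ⟧)  ≡⟨ ∑-cong p (λ x x<p → trans (shift x) (⟦∣⟧-residue x<p r<p)) ⟩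
    ∑ p (λ x → δ r x)            ≡⟨ ∑-cong p (λ x _ → sym (IP.*-identityʳ (δ r x))) ⟩
    ∑ p (λ x → δ r x * + 1)      ≡⟨ ∑-δ p (λ _ → + 1) r<p ⟩
    + 1                           ∎
    where
    r = (- t) %ℕ p
    q = (- t) /ℕ p
    r<p : r < p
    r<p = n%ℕd<d (- t) p
    regroup : ∀ r n x → - (r + n) + x ≡ (x - r) + - n
    regroup = solve-∀
    shift : ∀ x → ⟦ p ∣ t + + x ⟧ ≡ ⟦ p ∣ + x - + r ⟧
    shift x = begin
      ⟦ p ∣ t + + x ⟧                     ≡⟨ cong (λ z → ⟦ p ∣ z + + x ⟧) (IP.neg-involutive t) ⟨
      ⟦ p ∣ - - t + + x ⟧                 ≡⟨ cong (λ z → ⟦ p ∣ - z + + x ⟧) (a≡a%ℕn+[a/ℕn]*n (- t) p) ⟩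
      ⟦ p ∣ - (+ r + q * + p) + + x ⟧     ≡⟨ cong ⟦ p ∣_⟧ (regroup (+ r) (q * + p) (+ x)) ⟩
      ⟦ p ∣ (+ x - + r) + - (q * + p) ⟧   ≡⟨ ⟦∣⟧-+∣ (∣m⇒∣-m (∣n⇒∣m*n q ∣-refl)) (+ x - + r) ⟩
      ⟦ p ∣ + x - + r ⟧                   ∎

  sumℤ-filter-∣ : ∀ {A : Set} (w g : A → ℤ) L →
    sumℤ (map w (filter (λ x → + p ∣? g x) L)) ≡ sumℤ (map (λ x → w x * ⟦ p ∣ g x ⟧) L)
  sumℤ-filter-∣ w g []      = refl
  sumℤ-filter-∣ w g (x ∷ L) with + p ∣? g x
  ... | yes p∣gx = trans (cong (sumℤ ∘ map w) (LP.filter-accept (λ y → + p ∣? g y) p∣gx))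
                         (cong₂ _+_ (sym (IP.*-identityʳ (w x))) (sumℤ-filter-∣ w g L))
  ... | no  p∤gx = trans (cong (sumℤ ∘ map w) (LP.filter-reject (λ y → + p ∣? g y) p∤gx))
                         (trans (sumℤ-filter-∣ w g L)
                                (sym (trans (cong (_+ _) (IP.*-zeroʳ (w x))) (IP.+-identityˡ _))))

  length-filter-∣ : ∀ {A : Set} (g : A → ℤ) L →
    + length (filter (λ x → + p ∣? g x) L) ≡ sumℤ (map (λ x → ⟦ p ∣ g x ⟧) L)
  length-filter-∣ g L = begin
    + length (filter (λ x → + p ∣? g x) L)                ≡⟨ sym (sumℤ-map-1 (filter (λ x → + p ∣? g x) L)) ⟩
    sumℤ (map (λ _ → + 1) (filter (λ x → + p ∣? g x) L))  ≡⟨ sumℤ-filter-∣ (λ _ → + 1) g L ⟩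
    sumℤ (map (λ x → + 1 * ⟦ p ∣ g x ⟧) L)               ≡⟨ sumℤ-cong L (λ x → IP.*-identityˡ _) ⟩
    sumℤ (map (λ x → ⟦ p ∣ g x ⟧) L)                     ∎

Mᶜ : ℕ → (ℤ → ℤ) → ℤ → ℕ → ℤ
Mᶜ m f c p = sumℤ (map (λ xs → ⟦ p ∤ prodTerm f c xs ⟧) (tuples m p))

M≡p^m-Mᶜ : ∀ m f c p → + M (suc m) f c p ≡ (+ p) ^ m - Mᶜ m f c p
M≡p^m-Mᶜ m f c p = begin
  + M (suc m) f c p                      ≡⟨ sym (add-sub (+ M (suc m) f c p) (Mᶜ m f c p)) ⟩
  + M (suc m) f c p + Mᶜ m f c p - Mᶜ m f c p
    ≡⟨ cong (λ s → s + Mᶜ m f c p - Mᶜ m f c p) (length-filter-∣ g T) ⟩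
  sumℤ (map (λ xs → ⟦ p ∣ g xs ⟧) T) + Mᶜ m f c p - Mᶜ m f c p
    ≡⟨ cong (_- Mᶜ m f c p) (sym (sumℤ-map-+ (λ xs → ⟦ p ∣ g xs ⟧) (λ xs → ⟦ p ∤ g xs ⟧) T)) ⟩
  sumℤ (map (λ xs → ⟦ p ∣ g xs ⟧ + ⟦ p ∤ g xs ⟧) T) - Mᶜ m f c p
    ≡⟨ cong (_- Mᶜ m f c p) (sumℤ-cong T (⟦∣⟧+⟦∤⟧≡1 {p} ∘ g)) ⟩
  sumℤ (map (λ _ → + 1) T) - Mᶜ m f c p  ≡⟨ cong (_- Mᶜ m f c p) (trans (sumℤ-map-1 T) (length-tuples m p)) ⟩
  (+ p) ^ m - Mᶜ m f c p                   ∎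
  where
  g = prodTerm f c
  T = tuples m p
  add-sub : ∀ x y → x + y - y ≡ x
  add-sub = solve-∀

Mᶜ-zero : ∀ f c p → Mᶜ 0 f c p ≡ ⟦ p ∤ f c ⟧
Mᶜ-zero f c p = trans (IP.+-identityʳ _) (cong (λ z → ⟦ p ∤ z ⟧) (trans (IP.*-identityˡ _) (cong f (IP.+-identityʳ c))))

Mᶜ-suc : ∀ {p} → Prime p → ∀ m f c → Mᶜ (suc m) f c p ≡ ∑ p (λ x → ⟦ p ∤ f (+ x) ⟧ * Mᶜ m f (c - + x) p)
Mᶜ-suc {p} p-prime m f c = trans (sumℤ-tuples-suc m p _) (∑-cong p (λ x _ → begin
  sumℤ (map (λ xs → ⟦ p ∤ prodTerm f c (x ∷ xs) ⟧) (tuples m p))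
    ≡⟨ sumℤ-cong (tuples m p) (λ xs → trans (cong ⟦ p ∤_⟧ (prodTerm-∷ f c x xs)) (⟦∤⟧-* p-prime _ _)) ⟩
  sumℤ (map (λ xs → ⟦ p ∤ f (+ x) ⟧ * ⟦ p ∤ prodTerm f (c - + x) xs ⟧) (tuples m p))
    ≡⟨ sumℤ-map-*ˡ ⟦ p ∤ f (+ x) ⟧ (λ xs → ⟦ p ∤ prodTerm f (c - + x) xs ⟧) (tuples m p) ⟩
  ⟦ p ∤ f (+ x) ⟧ * Mᶜ m f (c - + x) p
    ∎))

module Quadratic (p a b : ℕ) where

  P : ℤ
  P = + p

  cond : ℕ → ℤ → ℕ → ℤ
  cond k c j = (+ a - + b) * + j - (c - + b * + k)

  B : ℕ → ℤ → ℤ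
  B k c = ∑ (suc k) (λ j → + (k C j) * ⟦ p ∣ cond k c j ⟧)

  binomSum≡B : ∀ k c → binomSum k (+ a) (+ b) c p ≡ B k c
  binomSum≡B k c = trans (sumℤ-filter-∣ {p} (λ j → + (k C j)) (cond k c) (upTo (suc k)))
                         (sumℤ-map-upTo (suc k) (λ j → + (k C j) * ⟦ p ∣ cond k c j ⟧))

  B-zero : ∀ c → B 0 c ≡ ⟦ p ∣ c ⟧
  B-zero c = begin
    + 1 * ⟦ p ∣ (+ a - + b) * + 0 - (c - + b * + 0) ⟧ + + 0  ≡⟨ trans (IP.+-identityʳ _) (IP.*-identityˡ _) ⟩
    ⟦ p ∣ (+ a - + b) * + 0 - (c - + b * + 0) ⟧              ≡⟨ cong ⟦ p ∣_⟧ (vanish (+ a - + b) (+ b) c) ⟩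
    ⟦ p ∣ - c ⟧                                              ≡⟨ ⟦∣⟧-neg c ⟩
    ⟦ p ∣ c ⟧                                                ∎
    where
    vanish : ∀ d b c → d * + 0 - (c - b * + 0) ≡ - c
    vanish = solve-∀

  B-suc : ∀ k c → B (suc k) c ≡ B k (c - + b) + B k (c - + a)
  B-suc k c = trans (∑-pascal k (λ j → ⟦ p ∣ cond (suc k) c j ⟧))
    (cong₂ _+_ (∑-cong (suc k) (λ j _ → cong (term j) (lower (+ a) (+ b) (+ j) c (+ k))))
               (∑-cong (suc k) (λ j _ → cong (term j) (upper (+ a) (+ b) (+ j) c (+ k)))))
    where
    term : ℕ → ℤ → ℤ
    term j z = + (k C j) * ⟦ p ∣ z ⟧
    lower : ∀ a b j c k → (a - b) * j - (c - b * (+ 1 + k)) ≡ (a - b) * j - ((c - b) - b * k)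
    lower = solve-∀
    upper : ∀ a b j c k → (a - b) * (+ 1 + j) - (c - b * (+ 1 + k)) ≡ (a - b) * j - ((c - a) - b * k)
    upper = solve-∀

  B-one : ∀ c → B 1 c ≡ ⟦ p ∣ c - + b ⟧ + ⟦ p ∣ c - + a ⟧
  B-one c = trans (B-suc 0 c) (cong₂ _+_ (B-zero (c - + b)) (B-zero (c - + a)))

  ∑-B : .{{_ : ℕ.NonZero p}} → ∀ k c → ∑ p (λ x → B k (c - + x)) ≡ (+ 2) ^ k
  ∑-B k c = begin
    ∑ p (λ x → ∑ (suc k) (λ j → + (k C j) * ⟦ p ∣ cond k (c - + x) j ⟧))
      ≡⟨ ∑-comm p (suc k) (λ x j → + (k C j) * ⟦ p ∣ cond k (c - + x) j ⟧) ⟩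
    ∑ (suc k) (λ j → ∑ p (λ x → + (k C j) * ⟦ p ∣ cond k (c - + x) j ⟧))
      ≡⟨ ∑-cong (suc k) (λ j _ → ∑-*ˡ p (+ (k C j)) (λ x → ⟦ p ∣ cond k (c - + x) j ⟧)) ⟩
    ∑ (suc k) (λ j → + (k C j) * ∑ p (λ x → ⟦ p ∣ cond k (c - + x) j ⟧))
      ≡⟨ ∑-cong (suc k) (λ j _ → cong (+ (k C j) *_) (each-class j)) ⟩
    ∑ (suc k) (λ j → + (k C j) * + 1)
      ≡⟨ trans (∑-cong (suc k) (λ j _ → IP.*-identityʳ (+ (k C j)))) (∑-binomial k) ⟩
    (+ 2) ^ k
      ∎
    where
    each-class : ∀ j → ∑ p (λ x → ⟦ p ∣ cond k (c - + x) j ⟧) ≡ + 1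
    each-class j = trans (∑-cong p (λ x _ → cong (λ z → ⟦ p ∣ z ⟧) (shift (+ a) (+ b) (+ j) c (+ k) (+ x))))
                         (∑-⟦∣+⟧ (cond k c j))
      where
      shift : ∀ a b j c k x → (a - b) * j - ((c - x) - b * k) ≡ ((a - b) * j - (c - b * k)) + x
      shift = solve-∀

  module Count (p-prime : Prime p) (a<p : a < p) (b<p : b < p) (a≢b : a ≢ b) where

    instance
      p≢0 : ℕ.NonZero p
      p≢0 = prime⇒nonZero p-prime

    f : ℤ → ℤ
    f = fab (+ a) (+ b)

    Φ : ℕ → ℤ → ℤ
    Φ k c = (- + 1) ^ k * (P * B k c + ((+ 2 - P) ^ k - (+ 2) ^ k))

    roots-distinct : ∀ z → ⟦ p ∣ z - + a ⟧ * ⟦ p ∣ z - + b ⟧ ≡ + 0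
    roots-distinct z with + p ∣? (z - + a) | + p ∣? (z - + b)
    ... | yes p∣z-a | yes p∣z-b = contradiction (∣m-n⇒m≡n a<p b<p (subst (+ p ∣_) (difference z (+ a) (+ b))
                                                                             (∣m∣n⇒∣m-n p∣z-b p∣z-a))) a≢b
      where
      difference : ∀ z a b → (z - b) - (z - a) ≡ a - b
      difference = solve-∀
    ... | no  _     | _         = refl
    ... | yes _     | no  _     = refl

    ⟦∤f⟧ : ∀ z → ⟦ p ∤ f z ⟧ ≡ + 1 - ⟦ p ∣ z - + a ⟧ - ⟦ p ∣ z - + b ⟧
    ⟦∤f⟧ z = begin
      ⟦ p ∤ (z - + a) * (z - + b) ⟧    ≡⟨ ⟦∤⟧-* p-prime (z - + a) (z - + b) ⟩
      (+ 1 - da) * (+ 1 - db)          ≡⟨ expand da db ⟩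
      + 1 - da - db + da * db          ≡⟨ cong (_+_ (+ 1 - da - db)) (roots-distinct z) ⟩
      + 1 - da - db + + 0              ≡⟨ IP.+-identityʳ _ ⟩
      + 1 - da - db                    ∎
      where
      da = ⟦ p ∣ z - + a ⟧
      db = ⟦ p ∣ z - + b ⟧
      expand : ∀ x y → (+ 1 - x) * (+ 1 - y) ≡ + 1 - x - y + x * y
      expand = solve-∀

    ∑-⟦∤f⟧* : ∀ h → ∑ p (λ x → ⟦ p ∤ f (+ x) ⟧ * h x) ≡ ∑ p h - h a - h b
    ∑-⟦∤f⟧* h = begin
      ∑ p (λ x → ⟦ p ∤ f (+ x) ⟧ * h x)                    ≡⟨ ∑-cong p (λ x x<p → value x x<p) ⟩
      ∑ p (λ x → (h x - δ a x * h x) - δ b x * h x)        ≡⟨ ∑-distrib-- p _ _ ⟩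
      ∑ p (λ x → h x - δ a x * h x) - ∑ p (λ x → δ b x * h x)
        ≡⟨ cong₂ _-_ (∑-distrib-- p h _) (∑-δ p h b<p) ⟩
      ∑ p h - ∑ p (λ x → δ a x * h x) - h b                ≡⟨ cong (λ s → ∑ p h - s - h b) (∑-δ p h a<p) ⟩
      ∑ p h - h a - h b                                    ∎
      where
      distrib : ∀ x y u → (+ 1 - x - y) * u ≡ (u - x * u) - y * u
      distrib = solve-∀
      value : ∀ x → x < p → ⟦ p ∤ f (+ x) ⟧ * h x ≡ (h x - δ a x * h x) - δ b x * h x
      value x x<p = trans (cong (_* h x) (trans (⟦∤f⟧ (+ x)) residues)) (distrib (δ a x) (δ b x) (h x))
        where
        residues : + 1 - ⟦ p ∣ + x - + a ⟧ - ⟦ p ∣ + x - + b ⟧ ≡ + 1 - δ a x - δ b x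
        residues = cong₂ (λ u v → + 1 - u - v) (⟦∣⟧-residue x<p a<p) (⟦∣⟧-residue x<p b<p)

    ∑-Φ : ∀ k c → ∑ p (λ x → Φ k (c - + x)) ≡ (- + 1) ^ k * (P * (+ 2) ^ k + P * ((+ 2 - P) ^ k - (+ 2) ^ k))
    ∑-Φ k c = begin
      ∑ p (λ x → s * (P * B k (c - + x) + w))    ≡⟨ ∑-*ˡ p s _ ⟩
      s * ∑ p (λ x → P * B k (c - + x) + w)      ≡⟨ cong (s *_) (∑-distrib-+ p _ _) ⟩
      s * (∑ p (λ x → P * B k (c - + x)) + ∑ p (λ _ → w))
        ≡⟨ cong₂ (λ u v → s * (u + v)) (trans (∑-*ˡ p P _) (cong (P *_) (∑-B k c))) (∑-const p w) ⟩
      s * (P * (+ 2) ^ k + P * w)                ∎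
      where
      s = (- + 1) ^ k
      w = (+ 2 - P) ^ k - (+ 2) ^ k

    p*Mᶜ≡Φ : ∀ m c → P * Mᶜ m f c p ≡ Φ (suc m) c
    p*Mᶜ≡Φ zero c = begin
      P * Mᶜ 0 f c p                          ≡⟨ cong (P *_) (trans (Mᶜ-zero f c p) (⟦∤f⟧ c)) ⟩
      P * (+ 1 - da - db)                     ≡⟨ base P da db ⟩
      (- + 1) * (P * (db + da) + w)           ≡⟨ cong (λ β → (- + 1) * (P * β + w)) (sym (B-one c)) ⟩
      Φ 1 c                                   ∎
      where
      da = ⟦ p ∣ c - + a ⟧
      db = ⟦ p ∣ c - + b ⟧
      w = (+ 2 - P) * + 1 - + 2
      base : ∀ P x y → P * (+ 1 - x - y) ≡ (- + 1) * (P * (y + x) + ((+ 2 - P) * + 1 - + 2))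
      base = solve-∀
    p*Mᶜ≡Φ (suc m) c = begin
      P * Mᶜ (suc m) f c p                                     ≡⟨ cong (P *_) (Mᶜ-suc p-prime m f c) ⟩
      P * ∑ p (λ x → ι x * Mᶜ m f (c - + x) p)                 ≡⟨ sym (∑-*ˡ p P (λ x → ι x * Mᶜ m f (c - + x) p)) ⟩
      ∑ p (λ x → P * (ι x * Mᶜ m f (c - + x) p))               ≡⟨ ∑-cong p (λ x _ → induction x) ⟩
      ∑ p (λ x → ι x * Φ k (c - + x))                          ≡⟨ ∑-⟦∤f⟧* (λ x → Φ k (c - + x)) ⟩
      ∑ p (λ x → Φ k (c - + x)) - Φ k (c - + a) - Φ k (c - + b)
        ≡⟨ cong (λ S → S - Φ k (c - + a) - Φ k (c - + b)) (∑-Φ k c) ⟩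
      s * (P * t + P * (v - t)) - s * (P * Ba + (v - t)) - s * (P * Bb + (v - t))
        ≡⟨ step P s t v Ba Bb ⟩
      (- + 1 * s) * (P * (Bb + Ba) + w′)
        ≡⟨ cong (λ β → (- + 1 * s) * (P * β + w′)) (sym (B-suc k c)) ⟩
      Φ (suc k) c                                              ∎
      where
      k = suc m
      s = (- + 1) ^ k
      v = (+ 2 - P) ^ k
      t = (+ 2) ^ k
      Ba = B k (c - + a)
      Bb = B k (c - + b)
      w′ = (+ 2 - P) * v - + 2 * t
      ι : ℕ → ℤ
      ι x = ⟦ p ∤ f (+ x) ⟧
      induction : ∀ x → P * (ι x * Mᶜ m f (c - + x) p) ≡ ι x * Φ k (c - + x)
      induction x = trans (left-comm P (ι x) _) (cong (ι x *_) (p*Mᶜ≡Φ m (c - + x)))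
        where
        left-comm : ∀ x y z → x * (y * z) ≡ y * (x * z)
        left-comm = solve-∀
      step : ∀ P s t v x y →
        s * (P * t + P * (v - t)) - s * (P * x + (v - t)) - s * (P * y + (v - t))
          ≡ (- + 1 * s) * (P * (y + x) + ((+ 2 - P) * v - + 2 * t))
      step = solve-∀

lemma2p4 : (p k : ℕ) (c : ℤ) (a b : ℕ) → Prime p → 2 ≤ k → a < p → b < p → a ≢ b →
    (+ p) * (+ M k (fab (+ a) (+ b)) c p)
      ≡ (+ p) ^ k
        - (- (+ 1)) ^ k * ((+ p) * binomSum k (+ a) (+ b) c p + (+ 2 - + p) ^ k - (+ 2) ^ k)
lemma2p4 p (suc m) c a b p-prime (s≤s _) a<p b<p a≢b = begin
  P * + M (suc m) f c p                           ≡⟨ cong (P *_) (M≡p^m-Mᶜ m f c p) ⟩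
  P * (P ^ m - Mᶜ m f c p)                        ≡⟨ distrib P (P ^ m) _ ⟩
  P ^ suc m - P * Mᶜ m f c p                      ≡⟨ cong (_-_ (P ^ suc m)) (p*Mᶜ≡Φ m c) ⟩
  P ^ suc m - s * (P * B (suc m) c + (v - t))
    ≡⟨ cong (λ β → P ^ suc m - s * (P * β + (v - t))) (sym (binomSum≡B (suc m) c)) ⟩
  P ^ suc m - s * (P * β + (v - t))               ≡⟨ cong (λ z → P ^ suc m - s * z) (IP.+-assoc (P * β) v (- t)) ⟨
  P ^ suc m - s * (P * β + v - t)                 ∎
  where
  open Quadratic p a b
  open Count p-prime a<p b<p a≢b
  s = (- + 1) ^ suc m
  v = (+ 2 - P) ^ suc m
  t = (+ 2) ^ suc m
  β = binomSum (suc m) (+ a) (+ b) c p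
  distrib : ∀ x y z → x * (y - z) ≡ x * y - x * z
  distrib = solve-∀
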